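{- For every positive integer $N$ and every integer $n\ge 1$, $$c_{N,n}=(-1)^n n!\sum_{k=1}^{n}\binom{n+1}{k+1}\sum_{\substack{i_1,\dots,i_k\ge 0\\ i_1+\cdots+i_k=n}}\frac{(-N)^k}{(N+i_1)\cdots(N+i_k)}.$$
   Context: The hypergeometric Cauchy numbers $c_{N,n}$ are defined by $\frac{1}{{}_2F_1(1,N;N+1;-x)}=\sum_{n=0}^\infty c_{N,n}\frac{x^n}{n!}$, where ${}_2F_1(a,b;c;z)=\sum_{n=0}^\infty\frac{(a)^{(n)}(b)^{(n)}}{(c)^{(n)}}\frac{z^n}{n!}$ with $(a)^{(n)}=a(a+1)\cdots(a+n-1)$ and $(a)^{(0)}=1$. Equivalently ${}_2F_1(1,N;N+1;-x)=N\sum_{j\ge0}\frac{(-x)^j}{N+j}$. -}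

module Defs where

open import Data.Nat as ℕ using (ℕ; zero; suc; _!)
open import Data.Nat.Combinatorics using (_C_)
open import Data.Integer using (+_)
open import Data.List using (List; []; _∷_; map; concatMap; foldr; upTo; zipWith)
open import Data.Rational using (ℚ; 0ℚ; 1ℚ; _+_; _*_; -_; _/_)

sumℚ : List ℚ → ℚ
sumℚ = foldr _+_ 0ℚ

prodℚ : List ℚ → ℚ
prodℚ = foldr _*_ 1ℚ

ℕ→ℚ : ℕ → ℚ
ℕ→ℚ n = (+ n) / 1

-- 1/d for a positive natural d (junk value 0 at d = 0; only ever used with d ≥ 1).
inv : ℕ → ℚ
inv zero    = 0ℚ
inv (suc d) = (+ 1) / suc d

_^ℚ_ : ℚ → ℕ → ℚ
q ^ℚ zero  = 1ℚ
q ^ℚ suc k = q * (q ^ℚ k)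

sgn : ℕ → ℚ
sgn n = (- 1ℚ) ^ℚ n

-- Coefficients of  2F1(1,N;N+1;-x) = N Σ_j (-x)^j/(N+j) = Σ_j a_j x^j,
--   a_j = (-1)^j N/(N+j).
hgCoeff : ℕ → ℕ → ℚ
hgCoeff N j = sgn j * (ℕ→ℚ N * inv (N ℕ.+ j))

-- Reciprocal of a formal power series  Σ a_j x^j  with a_0 = 1:
-- the unique series Σ b_n x^n with (Σ a_j x^j)(Σ b_n x^n) = 1, i.e.
--   b_0 = 1,   b_n = - Σ_{j=1}^{n} a_j b_{n-j}   (n ≥ 1).
-- recipList a n = [b_n, b_{n-1}, …, b_0].
recipList : (ℕ → ℚ) → ℕ → List ℚ
recipList a zero    = 1ℚ ∷ []
recipList a (suc n) =
  (- sumℚ (zipWith _*_ (map (λ j → a (suc j)) (upTo (suc n))) prev)) ∷ prev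
  where
    prev : List ℚ
    prev = recipList a n   -- [b_n, …, b_0]; b_{n+1-(j+1)} = b_{n-j} is entry j

headℚ : List ℚ → ℚ
headℚ []      = 0ℚ
headℚ (x ∷ _) = x

recipCoeff : (ℕ → ℚ) → ℕ → ℚ
recipCoeff a n = headℚ (recipList a n)

-- Hypergeometric Cauchy number c_{N,n}:
--   1 / 2F1(1,N;N+1;-x) = Σ_n c_{N,n} x^n / n!
c : ℕ → ℕ → ℚ
c N n = ℕ→ℚ (n !) * recipCoeff (hgCoeff N) n

compositions : ℕ → ℕ → List (List ℕ)
compositions zero    zero    = [] ∷ []
compositions zero    (suc n) = []
compositions (suc k) n =
  concatMap (λ i → map (i ∷_) (compositions k (n ℕ.∸ i))) (upTo (suc n))

term : ℕ → List ℕ → ℚ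
term N is = ((- ℕ→ℚ N) ^ℚ Data.List.length is) * prodℚ (map (λ i → inv (N ℕ.+ i)) is)

rhs : ℕ → ℕ → ℚ
rhs N n = sgn n * (ℕ→ℚ (n !) *
  sumℚ (map (λ k → ℕ→ℚ (suc n C suc k) *
                    sumℚ (map (term N) (compositions k n)))
            (Data.List.map suc (upTo n))))

{-# OPTIONS --safe #-}
-- Write A(x) = Σ a_j x^j for the series 2F1(1,N;N+1;-x), so a_0 = 1 and
-- a_j = (-1)^j N/(N+j). Since 1 - A has no constant term, (1 - A)^r starts in
-- degree r, and the geometric series 1/A = Σ_r (1 - A)^r gives the coefficient
--   [x^n] 1/A = Σ_{r ≤ n} Σ_k (-1)^k C(r,k) [x^n] A^k
--             = Σ_k (-1)^k C(n+1,k+1) [x^n] A^k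
-- by the hockey-stick identity. Finally [x^n] A^k is the sum over weak
-- compositions i_1+⋯+i_k = n of a_{i_1}⋯a_{i_k}, which pulls out the sign (-1)^n
-- and leaves the terms N^k/((N+i_1)⋯(N+i_k)).
module Submission where

open import Defs
open import Data.Nat using (ℕ; _≤_)
open import Relation.Binary.PropositionalEquality using (_≡_)

open import Function using (_∘_)
open import Data.Nat as ℕ using (zero; suc; _∸_; _<_; z≤n; s≤s; _!)
import Data.Nat.Properties as ℕP
open import Data.Nat.Combinatorics using (_C_; k>n⇒nCk≡0; nCk+nC[k+1]≡[n+1]C[k+1])
import Data.Integer as ℤ
import Data.Integer.Properties as ℤP
open import Data.List using (List; []; _∷_; _++_; map; concat; applyUpTo; downFrom; zipWith; length)
open import Data.List.Properties using (map-∘; map-cong; map-concatMap)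
open import Data.Rational using (ℚ; 0ℚ; 1ℚ; _+_; _*_; -_; toℚᵘ)
open import Data.Rational.Properties using (+-comm; toℚᵘ-injective; toℚᵘ-fromℚᵘ; toℚᵘ-homo-+; toℚᵘ-homo-*)
import Data.Rational.Unnormalised as ℚᵘ
import Data.Rational.Unnormalised.Properties as ℚᵘP
open import Data.Rational.Solver using (module +-*-Solver)
open +-*-Solver
open import Relation.Binary.PropositionalEquality using (refl; sym; trans; cong; cong₂; module ≡-Reasoning)

toℚᵘ-ℕ→ℚ : ∀ n → toℚᵘ (ℕ→ℚ n) ℚᵘ.≃ ℚᵘ.mkℚᵘ (ℤ.+ n) 0
toℚᵘ-ℕ→ℚ n = toℚᵘ-fromℚᵘ (ℚᵘ.mkℚᵘ (ℤ.+ n) 0)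

ℕ→ℚ-+ : ∀ m n → ℕ→ℚ (m ℕ.+ n) ≡ ℕ→ℚ m + ℕ→ℚ n
ℕ→ℚ-+ m n = toℚᵘ-injective (begin
  toℚᵘ (ℕ→ℚ (m ℕ.+ n))                      ≈⟨ toℚᵘ-ℕ→ℚ (m ℕ.+ n) ⟩
  ℚᵘ.mkℚᵘ (ℤ.+ (m ℕ.+ n)) 0                  ≈⟨ ℚᵘ.*≡* pos-+-scaled ⟩
  ℚᵘ.mkℚᵘ (ℤ.+ m) 0 ℚᵘ.+ ℚᵘ.mkℚᵘ (ℤ.+ n) 0  ≈⟨ ℚᵘP.+-cong (toℚᵘ-ℕ→ℚ m) (toℚᵘ-ℕ→ℚ n) ⟨
  toℚᵘ (ℕ→ℚ m) ℚᵘ.+ toℚᵘ (ℕ→ℚ n)            ≈⟨ toℚᵘ-homo-+ (ℕ→ℚ m) (ℕ→ℚ n) ⟨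
  toℚᵘ (ℕ→ℚ m + ℕ→ℚ n)                      ∎)
  where
  open ℚᵘP.≃-Reasoning
  pos-+-scaled : ℤ.+ (m ℕ.+ n) ℤ.* ℤ.+ 1 ≡ (ℤ.+ m ℤ.* ℤ.+ 1 ℤ.+ ℤ.+ n ℤ.* ℤ.+ 1) ℤ.* ℤ.+ 1
  pos-+-scaled = cong (ℤ._* ℤ.+ 1) (trans (ℤP.pos-+ m n)
    (sym (cong₂ ℤ._+_ (ℤP.*-identityʳ (ℤ.+ m)) (ℤP.*-identityʳ (ℤ.+ n)))))

ℕ→ℚ-*-inv : ∀ d → ℕ→ℚ (suc d) * inv (suc d) ≡ 1ℚ
ℕ→ℚ-*-inv d = toℚᵘ-injective (begin
  toℚᵘ (ℕ→ℚ (suc d) * inv (suc d))           ≈⟨ toℚᵘ-homo-* (ℕ→ℚ (suc d)) (inv (suc d)) ⟩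
  toℚᵘ (ℕ→ℚ (suc d)) ℚᵘ.* toℚᵘ (inv (suc d))
    ≈⟨ ℚᵘP.*-cong (toℚᵘ-ℕ→ℚ (suc d)) (toℚᵘ-fromℚᵘ (ℚᵘ.mkℚᵘ (ℤ.+ 1) d)) ⟩
  sd ℚᵘ.* ℚᵘ.1/ sd                           ≈⟨ ℚᵘP.*-inverseʳ sd ⟩
  ℚᵘ.1ℚᵘ                                     ∎)
  where
  open ℚᵘP.≃-Reasoning
  sd : ℚᵘ.ℚᵘ
  sd = ℚᵘ.mkℚᵘ (ℤ.+ suc d) 0

sgn-+ : ∀ m n → sgn (m ℕ.+ n) ≡ sgn m * sgn n
sgn-+ zero    n = solve 1 (λ x → x := con 1ℚ :* x) refl (sgn n)
sgn-+ (suc m) n = trans (cong ((- 1ℚ) *_) (sgn-+ m n))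
  (solve 3 (λ x y z → x :* (y :* z) := (x :* y) :* z) refl (- 1ℚ) (sgn m) (sgn n))

∑< : ℕ → (ℕ → ℚ) → ℚ
∑< zero    f = 0ℚ
∑< (suc n) f = f 0 + ∑< n (f ∘ suc)

syntax ∑< n (λ i → f) = ∑[ i < n ] f

∑-cong-< : ∀ n {f g : ℕ → ℚ} → (∀ i → i < n → f i ≡ g i) → ∑< n f ≡ ∑< n g
∑-cong-< zero    f≡g = refl
∑-cong-< (suc n) f≡g = cong₂ _+_ (f≡g 0 (s≤s z≤n)) (∑-cong-< n (λ i i<n → f≡g (suc i) (s≤s i<n)))

∑-cong : ∀ n {f g : ℕ → ℚ} → (∀ i → f i ≡ g i) → ∑< n f ≡ ∑< n g
∑-cong n f≡g = ∑-cong-< n (λ i _ → f≡g i)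

∑-0 : ∀ n → ∑[ _ < n ] 0ℚ ≡ 0ℚ
∑-0 zero    = refl
∑-0 (suc n) = cong (0ℚ +_) (∑-0 n)

∑-vanishing : ∀ n {f : ℕ → ℚ} → (∀ i → i < n → f i ≡ 0ℚ) → ∑< n f ≡ 0ℚ
∑-vanishing n f≡0 = trans (∑-cong-< n f≡0) (∑-0 n)

∑-distrib-+ : ∀ n (f g : ℕ → ℚ) → ∑[ i < n ] (f i + g i) ≡ ∑< n f + ∑< n g
∑-distrib-+ zero    f g = refl
∑-distrib-+ (suc n) f g = trans (cong ((f 0 + g 0) +_) (∑-distrib-+ n (f ∘ suc) (g ∘ suc)))
  (solve 4 (λ a b c d → (a :+ b) :+ (c :+ d) := (a :+ c) :+ (b :+ d)) refl (f 0) (g 0) _ _)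

*-distribˡ-∑ : ∀ n c (f : ℕ → ℚ) → c * ∑< n f ≡ ∑[ i < n ] (c * f i)
*-distribˡ-∑ zero    c f = solve 1 (λ c → c :* con 0ℚ := con 0ℚ) refl c
*-distribˡ-∑ (suc n) c f = trans
  (solve 3 (λ c a b → c :* (a :+ b) := c :* a :+ c :* b) refl c (f 0) _)
  (cong ((c * f 0) +_) (*-distribˡ-∑ n c (f ∘ suc)))

neg-distrib-∑ : ∀ n (f : ℕ → ℚ) → - ∑< n f ≡ ∑[ i < n ] (- f i)
neg-distrib-∑ n f = begin
  - ∑< n f                    ≡⟨ solve 1 (λ x → :- x := con (- 1ℚ) :* x) refl (∑< n f) ⟩
  (- 1ℚ) * ∑< n f             ≡⟨ *-distribˡ-∑ n (- 1ℚ) f ⟩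
  ∑[ i < n ] ((- 1ℚ) * f i)   ≡⟨ ∑-cong n (λ i → solve 1 (λ x → con (- 1ℚ) :* x := :- x) refl (f i)) ⟩
  ∑[ i < n ] (- f i)          ∎
  where open ≡-Reasoning

∑-init-last : ∀ n (f : ℕ → ℚ) → ∑< (suc n) f ≡ ∑< n f + f n
∑-init-last zero    f = solve 1 (λ x → x :+ con 0ℚ := con 0ℚ :+ x) refl (f 0)
∑-init-last (suc n) f = trans (cong (f 0 +_) (∑-init-last n (f ∘ suc)))
  (solve 3 (λ a b c → a :+ (b :+ c) := (a :+ b) :+ c) refl (f 0) _ _)

∑-swap : ∀ m n (f : ℕ → ℕ → ℚ) → ∑[ i < m ] ∑[ j < n ] f i j ≡ ∑[ j < n ] ∑[ i < m ] f i j
∑-swap zero    n f = sym (∑-0 n)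
∑-swap (suc m) n f = trans (cong (∑< n (f 0) +_) (∑-swap m n (f ∘ suc)))
  (sym (∑-distrib-+ n (f 0) (λ j → ∑[ i < m ] f (suc i) j)))

∑-extend : ∀ m p (f : ℕ → ℚ) → m ≤ p → (∀ i → m ≤ i → f i ≡ 0ℚ) → ∑< p f ≡ ∑< m f
∑-extend zero    p       f _         f≡0 = ∑-vanishing p (λ i _ → f≡0 i z≤n)
∑-extend (suc m) (suc p) f (s≤s m≤p) f≡0 =
  cong (f 0 +_) (∑-extend m p (f ∘ suc) m≤p (λ i m≤i → f≡0 (suc i) (s≤s m≤i)))

sumℚ-map-applyUpTo : ∀ {A : Set} n (F : A → ℚ) (g : ℕ → A) → sumℚ (map F (applyUpTo g n)) ≡ ∑[ i < n ] F (g i)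
sumℚ-map-applyUpTo zero    F g = refl
sumℚ-map-applyUpTo (suc n) F g = cong (F (g 0) +_) (sumℚ-map-applyUpTo n F (g ∘ suc))

sumℚ-++ : ∀ (xs ys : List ℚ) → sumℚ (xs ++ ys) ≡ sumℚ xs + sumℚ ys
sumℚ-++ []       ys = solve 1 (λ x → x := con 0ℚ :+ x) refl (sumℚ ys)
sumℚ-++ (x ∷ xs) ys = trans (cong (x +_) (sumℚ-++ xs ys))
  (solve 3 (λ a b c → a :+ (b :+ c) := (a :+ b) :+ c) refl x _ _)

sumℚ-concat-map : ∀ {A : Set} (H : A → List ℚ) (xs : List A) →
                 sumℚ (concat (map H xs)) ≡ sumℚ (map (sumℚ ∘ H) xs)
sumℚ-concat-map H []       = refl
sumℚ-concat-map H (x ∷ xs) = trans (sumℚ-++ (H x) (concat (map H xs)))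
  (cong (sumℚ (H x) +_) (sumℚ-concat-map H xs))

*-distribˡ-sumℚ : ∀ {A : Set} c (F : A → ℚ) (xs : List A) →
                  c * sumℚ (map F xs) ≡ sumℚ (map (λ x → c * F x) xs)
*-distribˡ-sumℚ c F []       = solve 1 (λ c → c :* con 0ℚ := con 0ℚ) refl c
*-distribˡ-sumℚ c F (x ∷ xs) = trans
  (solve 3 (λ c a b → c :* (a :+ b) := c :* a :+ c :* b) refl c (F x) _)
  (cong (c * F x +_) (*-distribˡ-sumℚ c F xs))

coeffPow : (ℕ → ℚ) → ℕ → ℕ → ℚ
coeffPow w k m = sumℚ (map (prodℚ ∘ map w) (compositions k m))

coeffPow-suc : ∀ w k m → coeffPow w (suc k) m ≡ ∑[ i < suc m ] (w i * coeffPow w k (m ∸ i))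
coeffPow-suc w k m = begin
  sumℚ (map prod (concat (map G is)))                  ≡⟨ cong sumℚ (map-concatMap prod G is) ⟩
  sumℚ (concat (map (map prod ∘ G) is))                ≡⟨ sumℚ-concat-map (map prod ∘ G) is ⟩
  sumℚ (map (sumℚ ∘ map prod ∘ G) is)                  ≡⟨ cong sumℚ (map-cong split-head is) ⟩
  sumℚ (map (λ i → w i * coeffPow w k (m ∸ i)) is)
    ≡⟨ sumℚ-map-applyUpTo (suc m) (λ i → w i * coeffPow w k (m ∸ i)) (λ i → i) ⟩
  ∑[ i < suc m ] (w i * coeffPow w k (m ∸ i))          ∎
  where
  open ≡-Reasoning
  prod : List ℕ → ℚ
  prod = prodℚ ∘ map w
  is : List ℕ
  is = applyUpTo (λ i → i) (suc m)
  G : ℕ → List (List ℕ)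
  G i = map (i ∷_) (compositions k (m ∸ i))
  split-head : ∀ i → sumℚ (map prod (G i)) ≡ w i * coeffPow w k (m ∸ i)
  split-head i = trans (cong sumℚ (sym (map-∘ (compositions k (m ∸ i)))))
    (sym (*-distribˡ-sumℚ (w i) prod (compositions k (m ∸ i))))

coeffPow-alternating : ∀ w k m → coeffPow (λ i → sgn i * w i) k m ≡ sgn m * coeffPow w k m
coeffPow-alternating w zero    zero    = solve 1 (λ x → x := con 1ℚ :* x) refl (coeffPow w 0 0)
coeffPow-alternating w zero    (suc m) = solve 1 (λ x → con 0ℚ := x :* con 0ℚ) refl (sgn (suc m))
coeffPow-alternating w (suc k) m = begin
  coeffPow v (suc k) m                            ≡⟨ coeffPow-suc v k m ⟩
  ∑[ i < suc m ] (v i * coeffPow v k (m ∸ i))     ≡⟨ ∑-cong-< (suc m) (λ i i<1+m → step i (ℕP.≤-pred i<1+m)) ⟩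
  ∑[ i < suc m ] (sgn m * (w i * coeffPow w k (m ∸ i))) ≡⟨ *-distribˡ-∑ (suc m) (sgn m) u ⟨
  sgn m * ∑[ i < suc m ] (w i * coeffPow w k (m ∸ i)) ≡⟨ cong (sgn m *_) (coeffPow-suc w k m) ⟨
  sgn m * coeffPow w (suc k) m                    ∎
  where
  open ≡-Reasoning
  v : ℕ → ℚ
  v i = sgn i * w i
  u : ℕ → ℚ
  u i = w i * coeffPow w k (m ∸ i)
  step : ∀ i → i ≤ m → v i * coeffPow v k (m ∸ i) ≡ sgn m * (w i * coeffPow w k (m ∸ i))
  step i i≤m = begin
    v i * coeffPow v k (m ∸ i)                          ≡⟨ cong (v i *_) (coeffPow-alternating w k (m ∸ i)) ⟩
    sgn i * w i * (sgn (m ∸ i) * coeffPow w k (m ∸ i))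
      ≡⟨ solve 4 (λ a b c d → a :* b :* (c :* d) := (a :* c) :* (b :* d)) refl (sgn i) (w i) (sgn (m ∸ i)) _ ⟩
    sgn i * sgn (m ∸ i) * (w i * coeffPow w k (m ∸ i))  ≡⟨ cong (_* (w i * coeffPow w k (m ∸ i))) sgn-split ⟩
    sgn m * (w i * coeffPow w k (m ∸ i))                ∎
    where
    sgn-split : sgn i * sgn (m ∸ i) ≡ sgn m
    sgn-split = trans (sym (sgn-+ i (m ∸ i))) (cong sgn (ℕP.m+[n∸m]≡n i≤m))

coeffPow-scale : ∀ c w k m → coeffPow (λ i → c * w i) k m ≡ c ^ℚ k * coeffPow w k m
coeffPow-scale c w zero    zero    = solve 1 (λ x → x := con 1ℚ :* x) refl (coeffPow w 0 0)
coeffPow-scale c w zero    (suc m) = refl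
coeffPow-scale c w (suc k) m = begin
  coeffPow v (suc k) m                                  ≡⟨ coeffPow-suc v k m ⟩
  ∑[ i < suc m ] (v i * coeffPow v k (m ∸ i))           ≡⟨ ∑-cong (suc m) step ⟩
  ∑[ i < suc m ] (c ^ℚ suc k * (w i * coeffPow w k (m ∸ i))) ≡⟨ *-distribˡ-∑ (suc m) (c ^ℚ suc k) u ⟨
  c ^ℚ suc k * ∑[ i < suc m ] (w i * coeffPow w k (m ∸ i))   ≡⟨ cong (c ^ℚ suc k *_) (coeffPow-suc w k m) ⟨
  c ^ℚ suc k * coeffPow w (suc k) m                     ∎
  where
  open ≡-Reasoning
  v : ℕ → ℚ
  v i = c * w i
  u : ℕ → ℚ
  u i = w i * coeffPow w k (m ∸ i)
  step : ∀ i → v i * coeffPow v k (m ∸ i) ≡ c ^ℚ suc k * (w i * coeffPow w k (m ∸ i))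
  step i = trans (cong (v i *_) (coeffPow-scale c w k (m ∸ i)))
    (solve 4 (λ a b c d → a :* b :* (c :* d) := (a :* c) :* (b :* d)) refl c (w i) (c ^ℚ k) _)

ℕ→ℚ-pascal : ∀ n k → ℕ→ℚ (suc n C suc k) ≡ ℕ→ℚ (n C k) + ℕ→ℚ (n C suc k)
ℕ→ℚ-pascal n k = trans (cong ℕ→ℚ (sym (nCk+nC[k+1]≡[n+1]C[k+1] n k))) (ℕ→ℚ-+ (n C k) (n C suc k))

∑-hockey-stick : ∀ n k → ∑[ r < suc n ] ℕ→ℚ (r C k) ≡ ℕ→ℚ (suc n C suc k)
∑-hockey-stick zero    zero    = refl
∑-hockey-stick zero    (suc k) = refl
∑-hockey-stick (suc n) k = begin
  ∑[ r < suc (suc n) ] ℕ→ℚ (r C k)                ≡⟨ ∑-init-last (suc n) (λ r → ℕ→ℚ (r C k)) ⟩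
  ∑[ r < suc n ] ℕ→ℚ (r C k) + ℕ→ℚ (suc n C k)    ≡⟨ cong (_+ ℕ→ℚ (suc n C k)) (∑-hockey-stick n k) ⟩
  ℕ→ℚ (suc n C suc k) + ℕ→ℚ (suc n C k)           ≡⟨ +-comm (ℕ→ℚ (suc n C suc k)) (ℕ→ℚ (suc n C k)) ⟩
  ℕ→ℚ (suc n C k) + ℕ→ℚ (suc n C suc k)           ≡⟨ ℕ→ℚ-pascal (suc n) k ⟨
  ℕ→ℚ (suc (suc n) C suc k)                       ∎
  where open ≡-Reasoning

recipList≡map-recipCoeff : ∀ a n → recipList a n ≡ map (recipCoeff a) (downFrom (suc n))
recipList≡map-recipCoeff a zero    = refl
recipList≡map-recipCoeff a (suc n) = cong (recipCoeff a (suc n) ∷_) (recipList≡map-recipCoeff a n)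

sumℚ-zipWith-reversed : ∀ (f g : ℕ → ℚ) m (h : ℕ → ℕ) →
  sumℚ (zipWith _*_ (map f (applyUpTo h m)) (map g (downFrom m))) ≡ ∑[ j < m ] (f (h j) * g (m ∸ suc j))
sumℚ-zipWith-reversed f g zero    h = refl
sumℚ-zipWith-reversed f g (suc m) h = cong (f (h 0) * g m +_) (sumℚ-zipWith-reversed f g m (h ∘ suc))

recipCoeff-suc : ∀ a n → recipCoeff a (suc n) ≡ - ∑[ j < suc n ] (a (suc j) * recipCoeff a (n ∸ j))
recipCoeff-suc a n = cong -_ (trans
  (cong (sumℚ ∘ zipWith _*_ (map (a ∘ suc) (applyUpTo (λ i → i) (suc n)))) (recipList≡map-recipCoeff a n))
  (sumℚ-zipWith-reversed (a ∘ suc) (recipCoeff a) (suc n) (λ i → i)))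

module Reciprocal (a : ℕ → ℚ) (a₀≡1 : a 0 ≡ 1ℚ) where
  open ≡-Reasoning

  binomialTerm : ℕ → ℕ → ℕ → ℚ
  binomialTerm r m k = sgn k * (ℕ→ℚ (r C k) * coeffPow a k m)

  coeff[1-A]^ : ℕ → ℕ → ℚ
  coeff[1-A]^ r m = ∑< (suc r) (binomialTerm r m)

  ∑-binomialTerm : ∀ r m p → r ≤ p → ∑< (suc p) (binomialTerm r m) ≡ coeff[1-A]^ r m
  ∑-binomialTerm r m p r≤p = ∑-extend (suc r) (suc p) (binomialTerm r m) (s≤s r≤p) vanishing
    where
    vanishing : ∀ k → suc r ≤ k → binomialTerm r m k ≡ 0ℚ
    vanishing k r<k = trans (cong (λ t → sgn k * (ℕ→ℚ t * coeffPow a k m)) (k>n⇒nCk≡0 r<k))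
      (solve 2 (λ s p → s :* (con 0ℚ :* p) := con 0ℚ) refl (sgn k) (coeffPow a k m))

  ∑-upper-binomialTerm : ∀ n m k → ∑[ r < suc n ] binomialTerm r m k ≡ sgn k * (ℕ→ℚ (suc n C suc k) * coeffPow a k m)
  ∑-upper-binomialTerm n m k = begin
    ∑[ r < suc n ] binomialTerm r m k                   ≡⟨ ∑-cong (suc n) (λ r → reorder (ℕ→ℚ (r C k))) ⟩
    ∑[ r < suc n ] (sgn k * coeffPow a k m * ℕ→ℚ (r C k))
      ≡⟨ *-distribˡ-∑ (suc n) (sgn k * coeffPow a k m) (λ r → ℕ→ℚ (r C k)) ⟨
    sgn k * coeffPow a k m * ∑[ r < suc n ] ℕ→ℚ (r C k) ≡⟨ cong (sgn k * coeffPow a k m *_) (∑-hockey-stick n k) ⟩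
    sgn k * coeffPow a k m * ℕ→ℚ (suc n C suc k)        ≡⟨ sym (reorder (ℕ→ℚ (suc n C suc k))) ⟩
    sgn k * (ℕ→ℚ (suc n C suc k) * coeffPow a k m)      ∎
    where
    reorder : ∀ c → sgn k * (c * coeffPow a k m) ≡ sgn k * coeffPow a k m * c
    reorder c = solve 3 (λ s c p → s :* (c :* p) := s :* p :* c) refl (sgn k) c (coeffPow a k m)

  shiftedTerm : ℕ → ℕ → ℕ → ℚ
  shiftedTerm r m k = sgn (suc k) * (ℕ→ℚ (r C k) * coeffPow a (suc k) m)

  coeff[1-A]^-pascal : ∀ r m → coeff[1-A]^ (suc r) m ≡ coeff[1-A]^ r m + ∑< (suc r) (shiftedTerm r m)
  coeff[1-A]^-pascal r m = begin
    binomialTerm r m 0 + ∑[ k < suc r ] binomialTerm (suc r) m (suc k)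
      ≡⟨ cong (binomialTerm r m 0 +_)
           (trans (∑-cong (suc r) split) (∑-distrib-+ (suc r) (binomialTerm r m ∘ suc) (shiftedTerm r m))) ⟩
    binomialTerm r m 0 + (∑[ k < suc r ] binomialTerm r m (suc k) + ∑< (suc r) (shiftedTerm r m))
      ≡⟨ solve 3 (λ x y z → x :+ (y :+ z) := (x :+ y) :+ z) refl (binomialTerm r m 0) _ (∑< (suc r) (shiftedTerm r m)) ⟩
    ∑< (suc (suc r)) (binomialTerm r m) + ∑< (suc r) (shiftedTerm r m)
      ≡⟨ cong (_+ ∑< (suc r) (shiftedTerm r m)) (∑-binomialTerm r m (suc r) (ℕP.n≤1+n r)) ⟩
    coeff[1-A]^ r m + ∑< (suc r) (shiftedTerm r m) ∎
    where
    split : ∀ k → binomialTerm (suc r) m (suc k) ≡ binomialTerm r m (suc k) + shiftedTerm r m k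
    split k = trans (cong (λ t → sgn (suc k) * (t * coeffPow a (suc k) m)) (ℕ→ℚ-pascal r k))
      (solve 4 (λ s x y p → s :* ((x :+ y) :* p) := s :* (y :* p) :+ s :* (x :* p)) refl
         (sgn (suc k)) (ℕ→ℚ (r C k)) (ℕ→ℚ (r C suc k)) (coeffPow a (suc k) m))

  ∑-shiftedTerm : ∀ r m → ∑< (suc r) (shiftedTerm r m) ≡ - ∑[ j < suc m ] (a j * coeff[1-A]^ r (m ∸ j))
  ∑-shiftedTerm r m = begin
    ∑< (suc r) (shiftedTerm r m)
      ≡⟨ ∑-cong (suc r) expand ⟩
    ∑[ k < suc r ] ∑[ j < suc m ] (- (a j * binomialTerm r (m ∸ j) k))
      ≡⟨ ∑-swap (suc r) (suc m) (λ k j → - (a j * binomialTerm r (m ∸ j) k)) ⟩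
    ∑[ j < suc m ] ∑[ k < suc r ] (- (a j * binomialTerm r (m ∸ j) k))
      ≡⟨ ∑-cong (suc m) collect ⟩
    ∑[ j < suc m ] (- (a j * coeff[1-A]^ r (m ∸ j)))
      ≡⟨ neg-distrib-∑ (suc m) (λ j → a j * coeff[1-A]^ r (m ∸ j)) ⟨
    - ∑[ j < suc m ] (a j * coeff[1-A]^ r (m ∸ j)) ∎
    where
    expand : ∀ k → shiftedTerm r m k ≡ ∑[ j < suc m ] (- (a j * binomialTerm r (m ∸ j) k))
    expand k = begin
      sgn (suc k) * (ℕ→ℚ (r C k) * coeffPow a (suc k) m)
        ≡⟨ cong (λ t → sgn (suc k) * (ℕ→ℚ (r C k) * t)) (coeffPow-suc a k m) ⟩
      sgn (suc k) * (ℕ→ℚ (r C k) * ∑[ j < suc m ] (a j * coeffPow a k (m ∸ j)))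
        ≡⟨ solve 3 (λ s c x → (con (- 1ℚ) :* s) :* (c :* x) := :- (s :* c) :* x) refl (sgn k) (ℕ→ℚ (r C k)) _ ⟩
      - (sgn k * ℕ→ℚ (r C k)) * ∑[ j < suc m ] (a j * coeffPow a k (m ∸ j))
        ≡⟨ *-distribˡ-∑ (suc m) (- (sgn k * ℕ→ℚ (r C k))) (λ j → a j * coeffPow a k (m ∸ j)) ⟩
      ∑[ j < suc m ] (- (sgn k * ℕ→ℚ (r C k)) * (a j * coeffPow a k (m ∸ j)))
        ≡⟨ ∑-cong (suc m) (λ j → solve 4 (λ s c x p → :- (s :* c) :* (x :* p) := :- (x :* (s :* (c :* p)))) refl
                                    (sgn k) (ℕ→ℚ (r C k)) (a j) (coeffPow a k (m ∸ j))) ⟩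
      ∑[ j < suc m ] (- (a j * binomialTerm r (m ∸ j) k)) ∎
    collect : ∀ j → ∑[ k < suc r ] (- (a j * binomialTerm r (m ∸ j) k)) ≡ - (a j * coeff[1-A]^ r (m ∸ j))
    collect j = trans (sym (neg-distrib-∑ (suc r) (λ k → a j * binomialTerm r (m ∸ j) k)))
      (cong -_ (sym (*-distribˡ-∑ (suc r) (a j) (binomialTerm r (m ∸ j)))))

  -- multiplying by 1 - A = - Σ_{j ≥ 1} a_j x^j
  coeff[1-A]^-suc : ∀ r m → coeff[1-A]^ (suc r) m ≡ - ∑[ j < m ] (a (suc j) * coeff[1-A]^ r (m ∸ suc j))
  coeff[1-A]^-suc r m = begin
    coeff[1-A]^ (suc r) m
      ≡⟨ coeff[1-A]^-pascal r m ⟩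
    coeff[1-A]^ r m + ∑< (suc r) (shiftedTerm r m)
      ≡⟨ cong (coeff[1-A]^ r m +_) (∑-shiftedTerm r m) ⟩
    coeff[1-A]^ r m + - (a 0 * coeff[1-A]^ r m + higher)
      ≡⟨ cong (λ t → coeff[1-A]^ r m + - (t * coeff[1-A]^ r m + higher)) a₀≡1 ⟩
    coeff[1-A]^ r m + - (1ℚ * coeff[1-A]^ r m + higher)
      ≡⟨ solve 2 (λ q x → q :+ :- (con 1ℚ :* q :+ x) := :- x) refl (coeff[1-A]^ r m) higher ⟩
    - higher ∎
    where
    higher : ℚ
    higher = ∑[ j < m ] (a (suc j) * coeff[1-A]^ r (m ∸ suc j))

  coeff[1-A]^-vanishing : ∀ r m → m < r → coeff[1-A]^ r m ≡ 0ℚ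
  coeff[1-A]^-vanishing (suc r) zero    _ = coeff[1-A]^-suc r zero
  coeff[1-A]^-vanishing (suc r) (suc m) (s≤s m<r) =
    trans (coeff[1-A]^-suc r (suc m)) (cong -_ (∑-vanishing (suc m) (λ j _ → vanishing j)))
    where
    vanishing : ∀ j → a (suc j) * coeff[1-A]^ r (m ∸ j) ≡ 0ℚ
    vanishing j = trans (cong (a (suc j) *_) (coeff[1-A]^-vanishing r (m ∸ j) (ℕP.≤-trans (s≤s (ℕP.m∸n≤m m j)) m<r)))
      (solve 1 (λ x → x :* con 0ℚ := con 0ℚ) refl (a (suc j)))

  geometric : ℕ → ℚ
  geometric m = ∑[ r < suc m ] coeff[1-A]^ r m

  ∑-coeff[1-A]^ : ∀ m p → m ≤ p → ∑[ r < suc p ] coeff[1-A]^ r m ≡ geometric m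
  ∑-coeff[1-A]^ m p m≤p =
    ∑-extend (suc m) (suc p) (λ r → coeff[1-A]^ r m) (s≤s m≤p) (λ r m<r → coeff[1-A]^-vanishing r m m<r)

  -- 1/A = 1/(1 - (1 - A)) = Σ_r (1 - A)^r; the bound n makes the induction structural
  recipCoeff≡geometric : ∀ m → recipCoeff a m ≡ geometric m
  recipCoeff≡geometric m = bounded m m ℕP.≤-refl
    where
    bounded : ∀ n m → m ≤ n → recipCoeff a m ≡ geometric m
    bounded n       zero    _         = refl
    bounded (suc n) (suc m) (s≤s m≤n) = begin
      recipCoeff a (suc m)
        ≡⟨ recipCoeff-suc a m ⟩
      - ∑[ j < suc m ] (a (suc j) * recipCoeff a (m ∸ j))
        ≡⟨ cong -_ (∑-cong-< (suc m) (λ j _ → cong (a (suc j) *_) (hypothesis j))) ⟩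
      - ∑[ j < suc m ] (a (suc j) * ∑[ r < suc m ] coeff[1-A]^ r (m ∸ j))
        ≡⟨ cong -_ (∑-cong (suc m) (λ j → *-distribˡ-∑ (suc m) (a (suc j)) (λ r → coeff[1-A]^ r (m ∸ j)))) ⟩
      - ∑[ j < suc m ] ∑[ r < suc m ] (a (suc j) * coeff[1-A]^ r (m ∸ j))
        ≡⟨ cong -_ (∑-swap (suc m) (suc m) (λ j r → a (suc j) * coeff[1-A]^ r (m ∸ j))) ⟩
      - ∑[ r < suc m ] ∑[ j < suc m ] (a (suc j) * coeff[1-A]^ r (m ∸ j))
        ≡⟨ neg-distrib-∑ (suc m) (λ r → ∑[ j < suc m ] (a (suc j) * coeff[1-A]^ r (m ∸ j))) ⟩
      ∑[ r < suc m ] (- ∑[ j < suc m ] (a (suc j) * coeff[1-A]^ r (m ∸ j)))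
        ≡⟨ ∑-cong (suc m) (λ r → sym (coeff[1-A]^-suc r (suc m))) ⟩
      ∑[ r < suc m ] coeff[1-A]^ (suc r) (suc m)
        ≡⟨ solve 1 (λ x → x := con 0ℚ :+ x) refl _ ⟩
      geometric (suc m) ∎
      where
      hypothesis : ∀ j → recipCoeff a (m ∸ j) ≡ ∑[ r < suc m ] coeff[1-A]^ r (m ∸ j)
      hypothesis j = trans (bounded n (m ∸ j) (ℕP.≤-trans (ℕP.m∸n≤m m j) m≤n))
        (sym (∑-coeff[1-A]^ (m ∸ j) m (ℕP.m∸n≤m m j)))

  recipCoeff-binomial : ∀ n → recipCoeff a n ≡ ∑[ k < suc n ] (sgn k * (ℕ→ℚ (suc n C suc k) * coeffPow a k n))
  recipCoeff-binomial n = begin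
    recipCoeff a n                                     ≡⟨ recipCoeff≡geometric n ⟩
    ∑[ r < suc n ] coeff[1-A]^ r n
      ≡⟨ ∑-cong-< (suc n) (λ r r<1+n → sym (∑-binomialTerm r n n (ℕP.≤-pred r<1+n))) ⟩
    ∑[ r < suc n ] ∑[ k < suc n ] binomialTerm r n k   ≡⟨ ∑-swap (suc n) (suc n) (λ r k → binomialTerm r n k) ⟩
    ∑[ k < suc n ] ∑[ r < suc n ] binomialTerm r n k   ≡⟨ ∑-cong (suc n) (∑-upper-binomialTerm n n) ⟩
    ∑[ k < suc n ] (sgn k * (ℕ→ℚ (suc n C suc k) * coeffPow a k n)) ∎

hgWeight : ℕ → ℕ → ℚ
hgWeight N i = ℕ→ℚ N * inv (N ℕ.+ i)

hgCoeff-0 : ∀ d → hgCoeff (suc d) 0 ≡ 1ℚ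
hgCoeff-0 d = trans (cong (λ t → sgn 0 * (ℕ→ℚ (suc d) * inv t)) (ℕP.+-identityʳ (suc d)))
  (cong (1ℚ *_) (ℕ→ℚ-*-inv d))

term≡prodℚ : ∀ N is → term N is ≡ prodℚ (map (λ i → - 1ℚ * hgWeight N i) is)
term≡prodℚ N []       = refl
term≡prodℚ N (i ∷ is) = trans
  (solve 4 (λ n y u v → (:- n :* y) :* (u :* v) := (con (- 1ℚ) :* (n :* u)) :* (y :* v)) refl
     (ℕ→ℚ N) ((- ℕ→ℚ N) ^ℚ length is) (inv (N ℕ.+ i)) (prodℚ (map (λ i → inv (N ℕ.+ i)) is)))
  (cong ((- 1ℚ * hgWeight N i) *_) (term≡prodℚ N is))

rhsTerm : ℕ → ℕ → ℕ → ℚ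
rhsTerm N n k = ℕ→ℚ (suc n C suc k) * (sgn k * coeffPow (hgWeight N) k n)

rhs≡∑rhsTerm : ∀ N n → rhs N n ≡ sgn n * (ℕ→ℚ (n !) * ∑[ k < n ] rhsTerm N n (suc k))
rhs≡∑rhsTerm N n = cong (λ t → sgn n * (ℕ→ℚ (n !) * t)) (begin
  sumℚ (map F (map suc (applyUpTo (λ i → i) n))) ≡⟨ cong sumℚ (map-∘ (applyUpTo (λ i → i) n)) ⟨
  sumℚ (map (F ∘ suc) (applyUpTo (λ i → i) n))   ≡⟨ sumℚ-map-applyUpTo n (F ∘ suc) (λ i → i) ⟩
  ∑[ k < n ] F (suc k)
    ≡⟨ ∑-cong n (λ k → cong (ℕ→ℚ (suc n C suc (suc k)) *_) (sumℚ-term (suc k))) ⟩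
  ∑[ k < n ] rhsTerm N n (suc k)                  ∎)
  where
  open ≡-Reasoning
  F : ℕ → ℚ
  F k = ℕ→ℚ (suc n C suc k) * sumℚ (map (term N) (compositions k n))
  sumℚ-term : ∀ k → sumℚ (map (term N) (compositions k n)) ≡ sgn k * coeffPow (hgWeight N) k n
  sumℚ-term k = trans (cong sumℚ (map-cong (term≡prodℚ N) (compositions k n)))
    (coeffPow-scale (- 1ℚ) (hgWeight N) k n)

-- The k = 0 summand vanishes because A^0 = 1 has no x^(n+1) term.
recipCoeff-hgCoeff : ∀ d n →
  recipCoeff (hgCoeff (suc d)) (suc n) ≡ sgn (suc n) * ∑[ k < suc n ] rhsTerm (suc d) (suc n) (suc k)
recipCoeff-hgCoeff d n = begin
  recipCoeff A m
    ≡⟨ Reciprocal.recipCoeff-binomial A (hgCoeff-0 d) m ⟩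
  sgn 0 * (ℕ→ℚ (suc m C 1) * 0ℚ) + ∑[ k < m ] (sgn (suc k) * (ℕ→ℚ (suc m C suc (suc k)) * coeffPow A (suc k) m))
    ≡⟨ solve 2 (λ c x → con 1ℚ :* (c :* con 0ℚ) :+ x := x) refl (ℕ→ℚ (suc m C 1)) _ ⟩
  ∑[ k < m ] (sgn (suc k) * (ℕ→ℚ (suc m C suc (suc k)) * coeffPow A (suc k) m))
    ≡⟨ ∑-cong m pull-sign ⟩
  ∑[ k < m ] (sgn m * rhsTerm N m (suc k))
    ≡⟨ *-distribˡ-∑ m (sgn m) (λ k → rhsTerm N m (suc k)) ⟨
  sgn m * ∑[ k < m ] rhsTerm N m (suc k) ∎
  where
  open ≡-Reasoning
  N m : ℕ
  N = suc d
  m = suc n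
  A : ℕ → ℚ
  A = hgCoeff N
  pull-sign : ∀ k → sgn (suc k) * (ℕ→ℚ (suc m C suc (suc k)) * coeffPow A (suc k) m) ≡ sgn m * rhsTerm N m (suc k)
  pull-sign k = trans
    (cong (λ t → sgn (suc k) * (ℕ→ℚ (suc m C suc (suc k)) * t)) (coeffPow-alternating (hgWeight N) (suc k) m))
    (solve 4 (λ s c t p → s :* (c :* (t :* p)) := t :* (c :* (s :* p))) refl
       (sgn (suc k)) (ℕ→ℚ (suc m C suc (suc k))) (sgn m) (coeffPow (hgWeight N) (suc k) m))

proposition1 : (N : ℕ) → 1 ≤ N → (n : ℕ) → 1 ≤ n → c N n ≡ rhs N n
proposition1 (suc d) _ (suc n) _ = begin
  ℕ→ℚ (m !) * recipCoeff (hgCoeff (suc d)) m              ≡⟨ cong (ℕ→ℚ (m !) *_) (recipCoeff-hgCoeff d n) ⟩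
  ℕ→ℚ (m !) * (sgn m * ∑[ k < m ] rhsTerm (suc d) m (suc k))
    ≡⟨ solve 3 (λ f s y → f :* (s :* y) := s :* (f :* y)) refl (ℕ→ℚ (m !)) (sgn m) _ ⟩
  sgn m * (ℕ→ℚ (m !) * ∑[ k < m ] rhsTerm (suc d) m (suc k)) ≡⟨ rhs≡∑rhsTerm (suc d) m ⟨
  rhs (suc d) m                                          ∎
  where
  open ≡-Reasoning
  m : ℕ
  m = suc n
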